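{- Let $(\mathscr{A},\preccurlyeq,\to,S)$ be an implicative algebra and $I$ a set. The following are equivalent: (1) The map $\rho_I:\mathsf{P}{I}\to(\mathsf{P}1)^I$ is injective. (2) The map $\rho_I:\mathsf{P}{I}\to(\mathsf{P}1)^I$ is an isomorphism of Heyting algebras. (3) Both separators $S[I]$ and $S^I$ coincide: $S[I]=S^I$. (4) The separator $S\subseteq\mathscr{A}$ is closed under all $I$-indexed meets.
   Context: An implicative structure is a complete lattice (meets $\bigwedge$) with $\to$ anti-monotonic in its first and monotonic in its second argument, commuting with arbitrary meets in its second argument; a separator is an upwards closed subset containing $\bigwedge_{a,b}(a\to b\to a)$ and $\bigwedge_{a,b,c}((a\to b\to c)\to(a\to b)\to a\to c)$ and closed under modus ponens. For a separator $T$ of a structure $\mathscr{B}$, $\mathscr{B}/T$ is the Heyting algebra obtained as poset reflection of $b\vdash_T b'$ iff $(b\to b')\in T$. In the product structure $\mathscr{A}^I$ (componentwise order and implication) there are two separators: the power separator $S^I=\prod_{i\in I}S$ and the uniform power separator $S[I]=\{a\in\mathscr{A}^I:\exists s\in S,\forall i\in I,\ s\preccurlyeq a_i\}\subseteq S^I$. Here $\mathsf{P}I=\mathscr{A}^I/S[I]$, $\mathsf{P}1\cong\mathscr{A}/S$, and $\rho_I:\mathscr{A}^I/S[I]\to(\mathscr{A}/S)^I$ is the surjective Heyting algebra morphism $\rho_I([(a_i)_{i\in I}]_{/S[I]})=([a_i]_{/S})_{i\in I}$. -}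

module Defs where

open import Level using (Level; suc; _⊔_)
open import Data.Product using (Σ; _×_; _,_; ∃)
open import Relation.Binary.PropositionalEquality using (_≡_)

-- An implicative structure: a complete lattice (all meets indexed by
-- types in Set ℓ, which includes all subsets of the carrier) with an
-- implication anti-monotone in its first argument, monotone in its
-- second, and commuting with arbitrary meets in its second argument.
record ImplicativeStructure (ℓ : Level) : Set (suc ℓ) where
  infix  4 _≼_
  infixr 5 _⇒_
  field
    Carrier   : Set ℓ
    _≼_       : Carrier → Carrier → Set ℓ
    ≼-refl    : ∀ {a} → a ≼ a
    ≼-trans   : ∀ {a b c} → a ≼ b → b ≼ c → a ≼ c
    ≼-antisym : ∀ {a b} → a ≼ b → b ≼ a → a ≡ b
    ⋀         : {J : Set ℓ} → (J → Carrier) → Carrier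
    ⋀-lower   : ∀ {J : Set ℓ} (f : J → Carrier) (j : J) → ⋀ f ≼ f j
    ⋀-greatest : ∀ {J : Set ℓ} (f : J → Carrier) (x : Carrier) →
                 (∀ j → x ≼ f j) → x ≼ ⋀ f
    _⇒_       : Carrier → Carrier → Carrier
    ⇒-mono    : ∀ {a a' b b'} → a' ≼ a → b ≼ b' → (a ⇒ b) ≼ (a' ⇒ b')
    ⇒-⋀       : ∀ {J : Set ℓ} (a : Carrier) (f : J → Carrier) →
                (a ⇒ ⋀ f) ≡ ⋀ (λ j → a ⇒ f j)

  𝐊 : Carrier
  𝐊 = ⋀ {Carrier × Carrier} (λ { (a , b) → a ⇒ b ⇒ a })

  𝐒 : Carrier
  𝐒 = ⋀ {Carrier × Carrier × Carrier}
        (λ { (a , b , c) → (a ⇒ b ⇒ c) ⇒ (a ⇒ b) ⇒ a ⇒ c })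

record IsSeparator {ℓ : Level} (𝒜 : ImplicativeStructure ℓ)
                   (S : ImplicativeStructure.Carrier 𝒜 → Set ℓ) : Set ℓ where
  open ImplicativeStructure 𝒜
  field
    upward : ∀ {a b} → a ≼ b → S a → S b
    K∈S    : S 𝐊
    S∈S    : S 𝐒
    mp     : ∀ {a b} → S (a ⇒ b) → S a → S b

record ImplicativeAlgebra (ℓ : Level) : Set (suc ℓ) where
  field
    structure : ImplicativeStructure ℓ
  open ImplicativeStructure structure public
  field
    Sep         : Carrier → Set ℓ
    isSeparator : IsSeparator structure Sep

module _ {ℓ : Level} (𝔸 : ImplicativeAlgebra ℓ) (I : Set ℓ) where
  open ImplicativeAlgebra 𝔸

  PowerSep : (I → Carrier) → Set ℓ
  PowerSep a = ∀ i → Sep (a i)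

  UniformSep : (I → Carrier) → Set ℓ
  UniformSep a = Σ Carrier (λ s → Sep s × (∀ i → s ≼ a i))

  _⇒ᴵ_ : (I → Carrier) → (I → Carrier) → (I → Carrier)
  (a ⇒ᴵ b) i = a i ⇒ b i

  -- order on P I = 𝒜^I / S[I]  (b ⊢_{S[I]} b')
  _⊢[I]_ : (I → Carrier) → (I → Carrier) → Set ℓ
  a ⊢[I] b = UniformSep (a ⇒ᴵ b)

  _≈[I]_ : (I → Carrier) → (I → Carrier) → Set ℓ
  a ≈[I] b = (a ⊢[I] b) × (b ⊢[I] a)

  -- order and equality of classes in P 1 ≅ 𝒜/S
  _⊢_ : Carrier → Carrier → Set ℓ
  a ⊢ b = Sep (a ⇒ b)

  _≈S_ : Carrier → Carrier → Set ℓ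
  a ≈S b = (a ⊢ b) × (b ⊢ a)

  -- order and equality in (P 1)^I (pointwise); ρ_I sends the class of
  -- (a_i)_i to the family of classes ([a_i])_i, so it is represented by
  -- the identity on representatives.
  _⊢ᴾ_ : (I → Carrier) → (I → Carrier) → Set ℓ
  a ⊢ᴾ b = ∀ i → a i ⊢ b i

  _≈ᴾ_ : (I → Carrier) → (I → Carrier) → Set ℓ
  a ≈ᴾ b = ∀ i → a i ≈S b i

  ρ-Injective : Set ℓ
  ρ-Injective = ∀ (a b : I → Carrier) → a ≈ᴾ b → a ≈[I] b

  -- (2) ρ_I is an isomorphism of Heyting algebras, i.e. an order
  -- isomorphism: it preserves and reflects the order, and is surjective.
  ρ-Isomorphism : Set ℓ
  ρ-Isomorphism =
    (∀ (a b : I → Carrier) → (a ⊢[I] b → a ⊢ᴾ b) × (a ⊢ᴾ b → a ⊢[I] b))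
    × (∀ (c : I → Carrier) → ∃ λ (a : I → Carrier) → a ≈ᴾ c)

  SeparatorsCoincide : Set ℓ
  SeparatorsCoincide =
    ∀ (a : I → Carrier) → (UniformSep a → PowerSep a) × (PowerSep a → UniformSep a)

  ClosedUnderMeets : Set ℓ
  ClosedUnderMeets = ∀ (f : I → Carrier) → (∀ i → Sep (f i)) → Sep (⋀ f)

{-# OPTIONS --safe #-}
module Submission where

-- S[I] ⊆ S^I always holds, and ρ_I is always monotone and surjective (it
-- is the identity on representatives), so all four conditions amount to
-- S^I ⊆ S[I].  If S is closed under I-indexed meets, ⋀ a is a uniform
-- witness for any a ∈ S^I.  Conversely, for f ∈ S^I the constant family ⊤
-- and f have the same image under ρ_I; injectivity then yields a single
-- s ∈ S below every ⊤ → f i, hence below ⊤ → ⋀ f, and so ⋀ f ∈ S.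

open import Defs
open import Level using (Level)
open import Data.Empty.Polymorphic using (⊥; ⊥-elim)
open import Data.Product using (_×_; _,_; proj₁; proj₂; ∃)
open import Function.Base using (_∘_)
open import Function.Bundles using (_⇔_; mk⇔)
open import Relation.Binary.PropositionalEquality using (subst; sym)

module ImplicativeStructureProperties {ℓ : Level} (𝒜 : ImplicativeStructure ℓ) where
  open ImplicativeStructure 𝒜

  ⊤ : Carrier
  ⊤ = ⋀ {J = ⊥} ⊥-elim

  x≼⊤ : ∀ x → x ≼ ⊤
  x≼⊤ x = ⋀-greatest ⊥-elim x λ ()

  ≼-⇒-⋀ : ∀ {J : Set ℓ} {x a} (f : J → Carrier) →
          (∀ j → x ≼ a ⇒ f j) → x ≼ a ⇒ ⋀ f
  ≼-⇒-⋀ {x = x} {a} f x≼a⇒f = subst (x ≼_) (sym (⇒-⋀ a f)) (⋀-greatest _ x x≼a⇒f)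

  𝐊-≼ : ∀ a b → 𝐊 ≼ a ⇒ b ⇒ a
  𝐊-≼ a b = ⋀-lower _ (a , b)

  𝐒-≼ : ∀ a b c → 𝐒 ≼ (a ⇒ b ⇒ c) ⇒ (a ⇒ b) ⇒ a ⇒ c
  𝐒-≼ a b c = ⋀-lower _ (a , b , c)

module SeparatorProperties {ℓ : Level} (𝔸 : ImplicativeAlgebra ℓ) where
  open ImplicativeAlgebra 𝔸
  open IsSeparator isSeparator
  open ImplicativeStructureProperties structure

  Sep-⊤ : Sep ⊤
  Sep-⊤ = upward (x≼⊤ 𝐊) K∈S

  Sep-const : ∀ {a b} → Sep a → Sep (b ⇒ a)
  Sep-const {a} {b} a∈S = mp (upward (𝐊-≼ a b) K∈S) a∈S

  Sep-id : ∀ a → Sep (a ⇒ a)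
  Sep-id a = mp (mp (upward (𝐒-≼ a (a ⇒ a) a) S∈S) (upward (𝐊-≼ a (a ⇒ a)) K∈S))
                (upward (𝐊-≼ a a) K∈S)

module PowerSeparatorProperties {ℓ : Level} (𝔸 : ImplicativeAlgebra ℓ) (I : Set ℓ) where
  open ImplicativeAlgebra 𝔸
  open IsSeparator isSeparator
  open ImplicativeStructureProperties structure
  open SeparatorProperties 𝔸

  UniformSep⊆PowerSep : ∀ a → UniformSep 𝔸 I a → PowerSep 𝔸 I a
  UniformSep⊆PowerSep a (s , s∈S , s≼a) i = upward (s≼a i) s∈S

  PowerSep⊆UniformSep : ClosedUnderMeets 𝔸 I → ∀ a → PowerSep 𝔸 I a → UniformSep 𝔸 I a
  PowerSep⊆UniformSep closed a a∈Sᴵ = ⋀ a , closed a a∈Sᴵ , ⋀-lower a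

  ρ-monotone : ∀ a b → _⊢[I]_ 𝔸 I a b → _⊢ᴾ_ 𝔸 I a b
  ρ-monotone a b = UniformSep⊆PowerSep (_⇒ᴵ_ 𝔸 I a b)

  ρ-surjective : ∀ c → ∃ λ a → _≈ᴾ_ 𝔸 I a c
  ρ-surjective c = c , λ i → Sep-id (c i) , Sep-id (c i)

  const⊤≈ᴾ : ∀ f → PowerSep 𝔸 I f → _≈ᴾ_ 𝔸 I (λ _ → ⊤) f
  const⊤≈ᴾ f f∈Sᴵ i = Sep-const (f∈Sᴵ i) , Sep-const Sep-⊤

  const⊤⊢[I]⇒Sep-⋀ : ∀ f → _⊢[I]_ 𝔸 I (λ _ → ⊤) f → Sep (⋀ f)
  const⊤⊢[I]⇒Sep-⋀ f (s , s∈S , s≼⊤⇒f) = mp (upward (≼-⇒-⋀ f s≼⊤⇒f) s∈S) Sep-⊤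

  injective⇒closed : ρ-Injective 𝔸 I → ClosedUnderMeets 𝔸 I
  injective⇒closed injective f f∈Sᴵ =
    const⊤⊢[I]⇒Sep-⋀ f (proj₁ (injective (λ _ → ⊤) f (const⊤≈ᴾ f f∈Sᴵ)))

  closed⇒coincide : ClosedUnderMeets 𝔸 I → SeparatorsCoincide 𝔸 I
  closed⇒coincide closed a = UniformSep⊆PowerSep a , PowerSep⊆UniformSep closed a

  coincide⇒isomorphism : SeparatorsCoincide 𝔸 I → ρ-Isomorphism 𝔸 I
  coincide⇒isomorphism coincide =
    (λ a b → ρ-monotone a b , proj₂ (coincide (_⇒ᴵ_ 𝔸 I a b))) , ρ-surjective

  isomorphism⇒injective : ρ-Isomorphism 𝔸 I → ρ-Injective 𝔸 I
  isomorphism⇒injective (order-iso , _) a b a≈ᴾb =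
    ρ-reflects a b (λ i → proj₁ (a≈ᴾb i)) , ρ-reflects b a (λ i → proj₂ (a≈ᴾb i))
    where
    ρ-reflects : ∀ a b → _⊢ᴾ_ 𝔸 I a b → _⊢[I]_ 𝔸 I a b
    ρ-reflects a b = proj₂ (order-iso a b)

proposition4p16 : {ℓ : Level} (𝔸 : ImplicativeAlgebra ℓ) (I : Set ℓ) →
    (ρ-Injective 𝔸 I ⇔ ρ-Isomorphism 𝔸 I)
    × (ρ-Injective 𝔸 I ⇔ SeparatorsCoincide 𝔸 I)
    × (ρ-Injective 𝔸 I ⇔ ClosedUnderMeets 𝔸 I)
proposition4p16 𝔸 I =
    mk⇔ (coincide⇒isomorphism ∘ injective⇒coincide) isomorphism⇒injective
  , mk⇔ injective⇒coincide (isomorphism⇒injective ∘ coincide⇒isomorphism)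
  , mk⇔ injective⇒closed (isomorphism⇒injective ∘ coincide⇒isomorphism ∘ closed⇒coincide)
  where
  open PowerSeparatorProperties 𝔸 I
  injective⇒coincide : ρ-Injective 𝔸 I → SeparatorsCoincide 𝔸 I
  injective⇒coincide = closed⇒coincide ∘ injective⇒closed
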